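{- Let $P$ be a finite poset of double type and let $r \in \{2,3\}$. Then there is a poset $P'$ of double type with $j(P') = 4j(P) + r$, obtained from $P$ by adding three elements (i.e. $P$ is an induced subposet of $P'$ and $|P'| = |P| + 3$).
   Context: For a finite poset $P$, $j(P)$ denotes the number of order ideals of $P$ (subsets $I$ with $y \in I$, $x<y \Rightarrow x \in I$), including the empty set. A dual order ideal of $P$ is a subset $I$ with $x \in I$, $x<y \Rightarrow y \in I$. $\bullet \oplus \bullet$ denotes the two-element chain. A poset is of double type if it contains a dual order ideal isomorphic (as an induced subposet) to the two-element chain $\bullet \oplus \bullet$. -}

module Defs where

open import Data.Nat using (ℕ; zero; suc)
open import Data.Bool using (Bool; true; false; _∧_; _∨_; not; if_then_else_)
open import Data.Fin using (Fin)
open import Data.Fin.Subset using (Subset; inside; outside)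
open import Data.Vec using (_∷_; []; lookup)
open import Data.List using (List; _∷_; []; map; _++_; length; filter; allFin)
open import Data.Product using (Σ; ∃; ∃-syntax; _×_)
open import Data.Sum using (_⊎_)
open import Relation.Binary.PropositionalEquality using (_≡_; _≢_)
open import Relation.Nullary using (¬_)
open import Data.Bool.Properties using (T?)
open import Data.Bool using (T)

record FinPoset (n : ℕ) : Set where
  field
    le      : Fin n → Fin n → Bool
    refl    : ∀ x → le x x ≡ true
    antisym : ∀ x y → le x y ≡ true → le y x ≡ true → x ≡ y
    trans   : ∀ x y z → le x y ≡ true → le y z ≡ true → le x z ≡ true

open FinPoset public

mem : ∀ {n} → Fin n → Subset n → Bool
mem x S = lookup S x

_⟨_<_⟩ : ∀ {n} → FinPoset n → Fin n → Fin n → Set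
P ⟨ x < y ⟩ = (le P x y ≡ true) × (x ≢ y)

IsDualOrderIdeal : ∀ {n} → FinPoset n → Subset n → Set
IsDualOrderIdeal P I = ∀ x y → mem x I ≡ true → P ⟨ x < y ⟩ → mem y I ≡ true

allᵇ : {A : Set} → (A → Bool) → List A → Bool
allᵇ p []       = true
allᵇ p (x ∷ xs) = p x ∧ allᵇ p xs

isOrderIdealᵇ : ∀ {n} → FinPoset n → Subset n → Bool
isOrderIdealᵇ {n} P I =
  allᵇ (λ y → allᵇ (λ x → not (mem y I ∧ le P x y) ∨ mem x I) (allFin n)) (allFin n)

allSubsets : (n : ℕ) → List (Subset n)
allSubsets zero    = [] ∷ []
allSubsets (suc n) = map (inside ∷_) (allSubsets n) ++ map (outside ∷_) (allSubsets n)

-- j(P): the number of order ideals of P (including the empty one).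
j : ∀ {n} → FinPoset n → ℕ
j {n} P = length (filter (λ I → T? (isOrderIdealᵇ P I)) (allSubsets n))

InducedTwoChain : ∀ {n} → FinPoset n → Subset n → Set
InducedTwoChain P D =
  ∃[ a ] ∃[ b ] (a ≢ b) × (le P a b ≡ true) ×
    (∀ x → (mem x D ≡ true) → (x ≡ a ⊎ x ≡ b)) ×
    (mem a D ≡ true) × (mem b D ≡ true)

DoubleType : ∀ {n} → FinPoset n → Set
DoubleType P = ∃[ D ] IsDualOrderIdeal P D × InducedTwoChain P D

InducedSubposet : ∀ {m n} → FinPoset m → FinPoset n → Set
InducedSubposet {m} {n} P Q =
  Σ (Fin m → Fin n) λ f →
    (∀ x y → f x ≡ f y → x ≡ y) × (∀ x y → le Q (f x) (f y) ≡ le P x y)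

module Submission where

-- Given an up-closed set U of P, add two incomparable elements new₁, new₂ and an element top
-- lying above new₁, new₂ and P ∖ U.  An order ideal avoiding top is an arbitrary subset of
-- {new₁, new₂} together with an order ideal of P, giving 4 j(P); an ideal containing top must
-- contain new₁, new₂ and P ∖ U, so these are counted by j(U).  The chain new₁ < top is a dual
-- order ideal, so the new poset is of double type.  If a < b is a dual order ideal of P, then U = {b} and U = {a, b} are up-closed
-- with j(U) = 2 and j(U) = 3.

open import Defs hiding (refl; trans; antisym)
open import Data.Nat using (ℕ; suc; _+_; _*_)
open import Data.Nat.Properties using (+-comm; +-suc; +-identityʳ; *-assoc)
open import Data.Bool using (Bool; true; false; _∧_; _∨_; not; T?)
import Data.Bool as Bool
open import Data.Bool.Properties using (⇔→≡; not-injective)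
open import Data.Fin using (Fin; zero; suc; _≟_)
open import Data.Fin.Properties using (suc-injective)
open import Data.Fin.Subset using (Subset; inside; outside; ⊥)
open import Data.Vec using ([]; _∷_; lookup; tabulate; head; tail)
open import Data.Vec.Properties using (lookup∘tabulate; tabulate∘lookup; tabulate-cong; lookup-replicate)
import Data.Vec.Properties as Vec
open import Data.List using (List; []; _∷_; map; _++_; length; filter; allFin)
open import Data.List.Properties using (filter-++; length-++)
open import Data.List.Relation.Unary.All as All using (All; []; _∷_)
open import Data.List.Relation.Unary.All.Properties using (All¬⇒¬Any)
open import Data.List.Relation.Unary.Any as Any using (here; there)
open import Data.List.Relation.Unary.AllPairs using ([]; _∷_)
open import Data.List.Relation.Unary.Unique.Propositional using (Unique)
open import Data.List.Membership.Propositional using (_∈_)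
open import Data.List.Membership.Propositional.Properties using (∈-allFin)
open import Data.Product using (Σ; _×_; _,_; proj₁; proj₂)
open import Data.Sum using (_⊎_; inj₁; inj₂)
open import Data.Empty using (⊥-elim)
open import Function using (_∘_; _⇔_; mk⇔; Equivalence)
open import Relation.Nullary using (Dec; yes; no; contradiction)
open import Relation.Nullary.Decidable using (does; dec-true; dec-false)
open import Relation.Binary.PropositionalEquality
  using (_≡_; _≢_; refl; sym; trans; cong; cong₂; subst; module ≡-Reasoning)

∧-elim : ∀ x {y} → x ∧ y ≡ true → x ≡ true × y ≡ true
∧-elim true  eq = refl , eq

∧-intro : ∀ {x y} → x ≡ true → y ≡ true → x ∧ y ≡ true
∧-intro refl refl = refl

∨-≡-true⇔ : ∀ x {y} → x ∨ y ≡ true ⇔ (x ≡ false → y ≡ true)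
∨-≡-true⇔ true  = mk⇔ (λ _ ()) (λ _ → refl)
∨-≡-true⇔ false = mk⇔ (λ eq _ → eq) (λ f → f refl)

implies-≡-true⇔ : ∀ x y {z} → not (x ∧ y) ∨ z ≡ true ⇔ (x ≡ true → y ≡ true → z ≡ true)
implies-≡-true⇔ true  true  = mk⇔ (λ eq _ _ → eq) (λ f → f refl refl)
implies-≡-true⇔ true  false = mk⇔ (λ _ _ ()) (λ _ → refl)
implies-≡-true⇔ false y     = mk⇔ (λ _ ()) (λ _ → refl)

does≡true⇔ : ∀ {A : Set} (d : Dec A) → does d ≡ true ⇔ A
does≡true⇔ (yes a) = mk⇔ (λ _ → a) (λ _ → refl)
does≡true⇔ (no ¬a) = mk⇔ (λ ()) (λ a → contradiction a ¬a)

allᵇ⇔All : ∀ {A : Set} (p : A → Bool) xs → allᵇ p xs ≡ true ⇔ All (λ x → p x ≡ true) xs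
allᵇ⇔All p []       = mk⇔ (λ _ → []) (λ _ → refl)
allᵇ⇔All p (x ∷ xs) = mk⇔
  (λ eq → let px , rest = ∧-elim (p x) eq in px ∷ Equivalence.to (allᵇ⇔All p xs) rest)
  (λ { (px ∷ rest) → ∧-intro px (Equivalence.from (allᵇ⇔All p xs) rest) })

allᵇ-allFin⇔ : ∀ {m} (p : Fin m → Bool) → allᵇ p (allFin m) ≡ true ⇔ (∀ x → p x ≡ true)
allᵇ-allFin⇔ {m} p = mk⇔
  (λ eq x → All.lookup (Equivalence.to (allᵇ⇔All p (allFin m)) eq) (∈-allFin x))
  (λ h → Equivalence.from (allᵇ⇔All p (allFin m)) (All.tabulate (λ {x} _ → h x)))

count : {A : Set} → (A → Bool) → List A → ℕ
count p xs = length (filter (T? ∘ p) xs)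

module _ {A : Set} where

  count-≗ : ∀ {p q : A → Bool} → (∀ x → p x ≡ q x) → ∀ xs → count p xs ≡ count q xs
  count-≗ h []       = refl
  count-≗ {p} {q} h (x ∷ xs) rewrite h x with q x
  ... | true  = cong suc (count-≗ h xs)
  ... | false = count-≗ h xs

  count-false : ∀ (xs : List A) → count (λ _ → false) xs ≡ 0
  count-false []       = refl
  count-false (x ∷ xs) = count-false xs

  count-++ : ∀ (p : A → Bool) xs ys → count p (xs ++ ys) ≡ count p xs + count p ys
  count-++ p xs ys =
    trans (cong length (filter-++ (T? ∘ p) xs ys)) (length-++ (filter (T? ∘ p) xs))

  count-map : ∀ {B : Set} (p : B → Bool) (f : A → B) xs → count p (map f xs) ≡ count (p ∘ f) xs
  count-map p f []       = refl
  count-map p f (x ∷ xs) with p (f x)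
  ... | true  = cong suc (count-map p f xs)
  ... | false = count-map p f xs

  count-∨ : ∀ (p q : A → Bool) → (∀ x → p x ≡ true → q x ≡ false) →
    ∀ xs → count (λ x → p x ∨ q x) xs ≡ count p xs + count q xs
  count-∨ p q disjoint []       = refl
  count-∨ p q disjoint (x ∷ xs) with p x in px
  ... | true rewrite disjoint x px = cong suc (count-∨ p q disjoint xs)
  ... | false with q x
  ...   | true  = trans (cong suc (count-∨ p q disjoint xs)) (sym (+-suc (count p xs) _))
  ...   | false = count-∨ p q disjoint xs

_≟ˢ_ : ∀ {m} → (I W : Subset m) → Dec (I ≡ W)
_≟ˢ_ = Vec.≡-dec Bool._≟_

module _ {m : ℕ} where

  count-allSubsets-suc : ∀ (p : Subset (suc m) → Bool) →
    count p (allSubsets (suc m)) ≡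
    count (p ∘ (inside ∷_)) (allSubsets m) + count (p ∘ (outside ∷_)) (allSubsets m)
  count-allSubsets-suc p = begin
    count p (map (inside ∷_) (allSubsets m) ++ map (outside ∷_) (allSubsets m))
      ≡⟨ count-++ p (map (inside ∷_) (allSubsets m)) _ ⟩
    count p (map (inside ∷_) (allSubsets m)) + count p (map (outside ∷_) (allSubsets m))
      ≡⟨ cong₂ _+_ (count-map p (inside ∷_) (allSubsets m)) (count-map p (outside ∷_) (allSubsets m)) ⟩
    count (p ∘ (inside ∷_)) (allSubsets m) + count (p ∘ (outside ∷_)) (allSubsets m) ∎
    where open ≡-Reasoning

  count-tail : ∀ (p : Subset m → Bool) → count (p ∘ tail) (allSubsets (suc m)) ≡ 2 * count p (allSubsets m)
  count-tail p = trans (count-allSubsets-suc (p ∘ tail))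
    (cong (count p (allSubsets m) +_) (sym (+-identityʳ (count p (allSubsets m)))))

  count-head-∧ : ∀ (p : Subset m → Bool) →
    count (λ J → head J ∧ p (tail J)) (allSubsets (suc m)) ≡ count p (allSubsets m)
  count-head-∧ p = trans (count-allSubsets-suc (λ J → head J ∧ p (tail J)))
    (trans (cong (count p (allSubsets m) +_) (count-false (allSubsets m))) (+-identityʳ _))

count-≟ˢ : ∀ {m} (W : Subset m) → count (λ I → does (I ≟ˢ W)) (allSubsets m) ≡ 1
count-≟ˢ []                = refl
count-≟ˢ {suc m} (w ∷ W) = trans (count-allSubsets-suc (λ I → does (I ≟ˢ (w ∷ W)))) (split w)
  where
  split : ∀ w → count (λ I → does ((inside ∷ I) ≟ˢ (w ∷ W))) (allSubsets m)
              + count (λ I → does ((outside ∷ I) ≟ˢ (w ∷ W))) (allSubsets m) ≡ 1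
  split inside  = cong₂ _+_ (count-≟ˢ W) (count-false (allSubsets m))
  split outside = cong₂ _+_ (count-false (allSubsets m)) (count-≟ˢ W)

_∈ˢ?_ : ∀ {m} (I : Subset m) (Ws : List (Subset m)) → Dec (I ∈ Ws)
I ∈ˢ? Ws = Any.any? (I ≟ˢ_) Ws

count-∈ˢ : ∀ {m} {Ws : List (Subset m)} → Unique Ws → count (λ I → does (I ∈ˢ? Ws)) (allSubsets m) ≡ length Ws
count-∈ˢ {m} {[]}     []               = count-false (allSubsets m)
count-∈ˢ {m} {W ∷ Ws} (W∉Ws ∷ unique) = begin
  count (λ I → does (I ≟ˢ W) ∨ does (I ∈ˢ? Ws)) (allSubsets m)
    ≡⟨ count-∨ _ _ disjoint (allSubsets m) ⟩
  count (λ I → does (I ≟ˢ W)) (allSubsets m) + count (λ I → does (I ∈ˢ? Ws)) (allSubsets m)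
    ≡⟨ cong₂ _+_ (count-≟ˢ W) (count-∈ˢ unique) ⟩
  suc (length Ws) ∎
  where
  open ≡-Reasoning
  disjoint : ∀ I → does (I ≟ˢ W) ≡ true → does (I ∈ˢ? Ws) ≡ false
  disjoint I _ with I ≟ˢ W | I ∈ˢ? Ws
  ... | yes refl | yes I∈Ws = contradiction I∈Ws (All¬⇒¬Any W∉Ws)
  ... | _        | no _     = refl

IsOrderIdeal : ∀ {n} → FinPoset n → Subset n → Set
IsOrderIdeal P I = ∀ x y → mem y I ≡ true → le P x y ≡ true → mem x I ≡ true

isOrderIdealᵇ⇔ : ∀ {n} (P : FinPoset n) I → isOrderIdealᵇ P I ≡ true ⇔ IsOrderIdeal P I
isOrderIdealᵇ⇔ P I = mk⇔
  (λ eq x y → Equivalence.to (implies-≡-true⇔ (mem y I) (le P x y))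
    (Equivalence.to (allᵇ-allFin⇔ _) (Equivalence.to (allᵇ-allFin⇔ _) eq y) x))
  (λ ideal → Equivalence.from (allᵇ-allFin⇔ _) λ y → Equivalence.from (allᵇ-allFin⇔ _) λ x →
    Equivalence.from (implies-≡-true⇔ (mem y I) (le P x y)) (ideal x y))

UpClosed : ∀ {n} → FinPoset n → (Fin n → Bool) → Set
UpClosed P u = ∀ p q → u p ≡ true → le P p q ≡ true → u q ≡ true

Covers : ∀ {n} → (Fin n → Bool) → Subset n → Set
Covers u I = ∀ p → u p ≡ false → mem p I ≡ true

coversᵇ : ∀ {n} → (Fin n → Bool) → Subset n → Bool
coversᵇ {n} u I = allᵇ (λ p → u p ∨ mem p I) (allFin n)

coversᵇ⇔ : ∀ {n} (u : Fin n → Bool) I → coversᵇ u I ≡ true ⇔ Covers u I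
coversᵇ⇔ u I = mk⇔
  (λ eq p → Equivalence.to (∨-≡-true⇔ (u p)) (Equivalence.to (allᵇ-allFin⇔ _) eq p))
  (λ covers → Equivalence.from (allᵇ-allFin⇔ _) λ p → Equivalence.from (∨-≡-true⇔ (u p)) (covers p))

-- For up-closed u this is j of the subposet u: I ↦ I ∩ u is a bijection onto its order ideals.
jOn : ∀ {n} → FinPoset n → (Fin n → Bool) → ℕ
jOn {n} P u = count (λ I → coversᵇ u I ∧ isOrderIdealᵇ P I) (allSubsets n)

module Extension {n} (P : FinPoset n) (u : Fin n → Bool) (u-up : UpClosed P u) where

  pattern top   = zero
  pattern new₁  = suc zero
  pattern new₂  = suc (suc zero)
  pattern old p = suc (suc (suc p))

  leᵉ : Fin (3 + n) → Fin (3 + n) → Bool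
  leᵉ (old p) top     = not (u p)
  leᵉ _       top     = true
  leᵉ new₁    new₁    = true
  leᵉ new₂    new₂    = true
  leᵉ (old p) (old q) = le P p q
  leᵉ _       _       = false

  reflᵉ : ∀ x → leᵉ x x ≡ true
  reflᵉ top     = refl
  reflᵉ new₁    = refl
  reflᵉ new₂    = refl
  reflᵉ (old p) = FinPoset.refl P p

  antisymᵉ : ∀ x y → leᵉ x y ≡ true → leᵉ y x ≡ true → x ≡ y
  antisymᵉ top     top     _ _ = refl
  antisymᵉ new₁    new₁    _ _ = refl
  antisymᵉ new₂    new₂    _ _ = refl
  antisymᵉ (old p) (old q) p≤q q≤p = cong old (FinPoset.antisym P p q p≤q q≤p)
  antisymᵉ top     new₁    () _
  antisymᵉ top     new₂    () _
  antisymᵉ top     (old q) () _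
  antisymᵉ new₁    top     _ ()
  antisymᵉ new₁    new₂    () _
  antisymᵉ new₁    (old q) () _
  antisymᵉ new₂    top     _ ()
  antisymᵉ new₂    new₁    () _
  antisymᵉ new₂    (old q) () _
  antisymᵉ (old p) top     _ ()
  antisymᵉ (old p) new₁    () _
  antisymᵉ (old p) new₂    () _

  below-top-downward : ∀ p q → le P p q ≡ true → not (u q) ≡ true → not (u p) ≡ true
  below-top-downward p q p≤q q∉u with u p in p∈u
  ... | false = refl
  ... | true  = subst (λ b → not b ≡ true) (u-up p q p∈u p≤q) q∉u

  transᵉ : ∀ x y z → leᵉ x y ≡ true → leᵉ y z ≡ true → leᵉ x z ≡ true
  transᵉ top     top     z       _   y≤z = y≤z
  transᵉ new₁    _       top     _   _   = refl
  transᵉ new₂    _       top     _   _   = refl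
  transᵉ new₁    new₁    z       _   y≤z = y≤z
  transᵉ new₂    new₂    z       _   y≤z = y≤z
  transᵉ (old p) top     top     x≤y _   = x≤y
  transᵉ (old p) (old q) top     x≤y y≤z = below-top-downward p q x≤y y≤z
  transᵉ (old p) (old q) (old r) x≤y y≤z = FinPoset.trans P p q r x≤y y≤z
  transᵉ top     new₁    _       ()  _
  transᵉ top     new₂    _       ()  _
  transᵉ top     (old q) _       ()  _
  transᵉ new₁    top     (suc z) _   ()
  transᵉ new₁    new₂    _       ()  _
  transᵉ new₁    (old q) _       ()  _
  transᵉ new₂    top     (suc z) _   ()
  transᵉ new₂    new₁    _       ()  _
  transᵉ new₂    (old q) _       ()  _
  transᵉ (old p) top     (suc z) _   ()
  transᵉ (old p) new₁    _       ()  _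
  transᵉ (old p) new₂    _       ()  _
  transᵉ (old p) (old q) new₁    _   ()
  transᵉ (old p) (old q) new₂    _   ()

  ext : FinPoset (3 + n)
  ext = record { le = leᵉ ; refl = reflᵉ ; antisym = antisymᵉ ; trans = transᵉ }

  restrict-ideal : ∀ {c₀ c₁ c₂ I} → IsOrderIdeal ext (c₀ ∷ c₁ ∷ c₂ ∷ I) → IsOrderIdeal P I
  restrict-ideal ideal p q = ideal (old p) (old q)

  ideal-with-top : ∀ {c₁ c₂ I} → IsOrderIdeal ext (true ∷ c₁ ∷ c₂ ∷ I) →
    c₁ ≡ true × c₂ ≡ true × Covers u I
  ideal-with-top ideal =
    ideal new₁ top refl refl , ideal new₂ top refl refl ,
    λ p p∉u → ideal (old p) top refl (cong not p∉u)

  extend-ideal : ∀ {c₀ c₁ c₂ I} → IsOrderIdeal P I →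
    (c₀ ≡ true → c₁ ≡ true × c₂ ≡ true × Covers u I) → IsOrderIdeal ext (c₀ ∷ c₁ ∷ c₂ ∷ I)
  extend-ideal ideal top-in top     top     top∈J _ = top∈J
  extend-ideal ideal top-in new₁    top     top∈J _ = proj₁ (top-in top∈J)
  extend-ideal ideal top-in new₂    top     top∈J _ = proj₁ (proj₂ (top-in top∈J))
  extend-ideal ideal top-in (old p) top     top∈J p∉u =
    proj₂ (proj₂ (top-in top∈J)) p (not-injective p∉u)
  extend-ideal ideal top-in new₁    new₁    y∈J _ = y∈J
  extend-ideal ideal top-in new₂    new₂    y∈J _ = y∈J
  extend-ideal ideal top-in (old p) (old q) q∈I p≤q = ideal p q q∈I p≤q
  extend-ideal ideal top-in top     (suc y) _ ()
  extend-ideal ideal top-in new₁    new₂    _ ()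
  extend-ideal ideal top-in new₁    (old q) _ ()
  extend-ideal ideal top-in new₂    new₁    _ ()
  extend-ideal ideal top-in new₂    (old q) _ ()
  extend-ideal ideal top-in (old p) new₁    _ ()
  extend-ideal ideal top-in (old p) new₂    _ ()

  idealᵇ-without-top : ∀ c₁ c₂ I → isOrderIdealᵇ ext (false ∷ c₁ ∷ c₂ ∷ I) ≡ isOrderIdealᵇ P I
  idealᵇ-without-top c₁ c₂ I = ⇔→≡ (mk⇔
    (λ eq → Equivalence.from (isOrderIdealᵇ⇔ P I)
      (restrict-ideal (Equivalence.to (isOrderIdealᵇ⇔ ext (false ∷ c₁ ∷ c₂ ∷ I)) eq)))
    (λ eq → Equivalence.from (isOrderIdealᵇ⇔ ext (false ∷ c₁ ∷ c₂ ∷ I))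
      (extend-ideal (Equivalence.to (isOrderIdealᵇ⇔ P I) eq) λ ())))

  idealᵇ-with-top : ∀ c₁ c₂ I →
    isOrderIdealᵇ ext (true ∷ c₁ ∷ c₂ ∷ I) ≡ c₁ ∧ c₂ ∧ coversᵇ u I ∧ isOrderIdealᵇ P I
  idealᵇ-with-top c₁ c₂ I = ⇔→≡ (mk⇔ to from)
    where
    to : isOrderIdealᵇ ext (true ∷ c₁ ∷ c₂ ∷ I) ≡ true → c₁ ∧ c₂ ∧ coversᵇ u I ∧ isOrderIdealᵇ P I ≡ true
    to eq = let ideal = Equivalence.to (isOrderIdealᵇ⇔ ext (true ∷ c₁ ∷ c₂ ∷ I)) eq
                c₁∈J , c₂∈J , covers = ideal-with-top ideal in
      ∧-intro c₁∈J (∧-intro c₂∈J (∧-intro (Equivalence.from (coversᵇ⇔ u I) covers)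
          (Equivalence.from (isOrderIdealᵇ⇔ P I) (restrict-ideal ideal))))
    from : c₁ ∧ c₂ ∧ coversᵇ u I ∧ isOrderIdealᵇ P I ≡ true → isOrderIdealᵇ ext (true ∷ c₁ ∷ c₂ ∷ I) ≡ true
    from eq = let c₁∈J , rest₁ = ∧-elim c₁ eq
                  c₂∈J , rest₂ = ∧-elim c₂ rest₁
                  covers , ideal = ∧-elim (coversᵇ u I) rest₂ in
      Equivalence.from (isOrderIdealᵇ⇔ ext (true ∷ c₁ ∷ c₂ ∷ I)) (extend-ideal (Equivalence.to (isOrderIdealᵇ⇔ P I) ideal)
          λ _ → c₁∈J , c₂∈J , Equivalence.to (coversᵇ⇔ u I) covers)

  j-ext : j ext ≡ 4 * j P + jOn P u
  j-ext = begin
    j ext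
      ≡⟨ count-allSubsets-suc (isOrderIdealᵇ ext) ⟩
    count (λ J → isOrderIdealᵇ ext (true ∷ J)) (allSubsets (2 + n)) +
    count (λ J → isOrderIdealᵇ ext (false ∷ J)) (allSubsets (2 + n))
      ≡⟨ cong₂ _+_ with-top without-top ⟩
    jOn P u + 2 * (2 * j P)
      ≡⟨ +-comm (jOn P u) _ ⟩
    2 * (2 * j P) + jOn P u
      ≡⟨ cong (_+ jOn P u) (sym (*-assoc 2 2 (j P))) ⟩
    4 * j P + jOn P u ∎
    where
    open ≡-Reasoning
    inP : Subset n → Bool
    inP I = coversᵇ u I ∧ isOrderIdealᵇ P I
    with-top : count (λ J → isOrderIdealᵇ ext (true ∷ J)) (allSubsets (2 + n)) ≡ jOn P u
    with-top = begin
      count (λ J → isOrderIdealᵇ ext (true ∷ J)) (allSubsets (2 + n))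
        ≡⟨ count-≗ (λ { (c₁ ∷ c₂ ∷ I) → idealᵇ-with-top c₁ c₂ I }) (allSubsets (2 + n)) ⟩
      count (λ J → head J ∧ head (tail J) ∧ inP (tail (tail J))) (allSubsets (2 + n))
        ≡⟨ count-head-∧ (λ J → head J ∧ inP (tail J)) ⟩
      count (λ J → head J ∧ inP (tail J)) (allSubsets (1 + n))
        ≡⟨ count-head-∧ inP ⟩
      jOn P u ∎
    without-top : count (λ J → isOrderIdealᵇ ext (false ∷ J)) (allSubsets (2 + n)) ≡ 2 * (2 * j P)
    without-top = begin
      count (λ J → isOrderIdealᵇ ext (false ∷ J)) (allSubsets (2 + n))
        ≡⟨ count-≗ (λ { (c₁ ∷ c₂ ∷ I) → idealᵇ-without-top c₁ c₂ I }) (allSubsets (2 + n)) ⟩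
      count (isOrderIdealᵇ P ∘ tail ∘ tail) (allSubsets (2 + n))
        ≡⟨ count-tail (isOrderIdealᵇ P ∘ tail) ⟩
      2 * count (isOrderIdealᵇ P ∘ tail) (allSubsets (1 + n))
        ≡⟨ cong (2 *_) (count-tail (isOrderIdealᵇ P)) ⟩
      2 * (2 * j P) ∎

  chain : Subset (3 + n)
  chain = inside ∷ inside ∷ outside ∷ ⊥

  ∉⊥ : ∀ p → mem p (⊥ {n}) ≢ true
  ∉⊥ p p∈⊥ with () ← trans (sym (lookup-replicate p outside)) p∈⊥

  chain-dual : IsDualOrderIdeal ext chain
  chain-dual x       top     _   _       = refl
  chain-dual x       new₁    _   _       = refl
  chain-dual top     (suc y) _   (() , _)
  chain-dual new₁    new₂    _   (() , _)
  chain-dual new₁    (old q) _   (() , _)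
  chain-dual new₂    _       ()  _
  chain-dual (old p) _       p∈⊥ _       = ⊥-elim (∉⊥ p p∈⊥)

  in-chain : ∀ x → mem x chain ≡ true → x ≡ new₁ ⊎ x ≡ top
  in-chain top     _   = inj₂ refl
  in-chain new₁    _   = inj₁ refl
  in-chain new₂    ()
  in-chain (old p) p∈⊥ = ⊥-elim (∉⊥ p p∈⊥)

  ext-doubleType : DoubleType ext
  ext-doubleType = chain , chain-dual , new₁ , top , (λ ()) , refl , in-chain , refl , refl

  P-induced : InducedSubposet P ext
  P-induced = (λ p → old p) , (λ _ _ eq → suc-injective (suc-injective (suc-injective eq))) , λ _ _ → refl

ExtensionOf : ∀ {n} → FinPoset n → ℕ → ℕ → Set
ExtensionOf P r m = Σ (FinPoset m) λ P' → DoubleType P' × (j P' ≡ 4 * j P + r) × InducedSubposet P P'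

extension-of-upClosed : ∀ {n r} (P : FinPoset n) (u : Fin n → Bool) → UpClosed P u →
  jOn P u ≡ r → ExtensionOf P r (3 + n)
extension-of-upClosed P u u-up jOn≡r =
  ext , ext-doubleType , trans j-ext (cong (4 * j P +_) jOn≡r) , P-induced
  where open Extension P u u-up

jOn-enumerated : ∀ {n} (P : FinPoset n) (u : Fin n → Bool) {Ws : List (Subset n)} →
  (∀ I → (Covers u I × IsOrderIdeal P I) ⇔ I ∈ Ws) → Unique Ws → jOn P u ≡ length Ws
jOn-enumerated {n} P u {Ws} enumerates unique =
  trans (count-≗ same-predicate (allSubsets n)) (count-∈ˢ unique)
  where
  same-predicate : ∀ I → coversᵇ u I ∧ isOrderIdealᵇ P I ≡ does (I ∈ˢ? Ws)
  same-predicate I = ⇔→≡ (mk⇔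
    (λ eq → let covers , ideal = ∧-elim (coversᵇ u I) eq in
      Equivalence.from (does≡true⇔ (I ∈ˢ? Ws)) (Equivalence.to (enumerates I)
        (Equivalence.to (coversᵇ⇔ u I) covers , Equivalence.to (isOrderIdealᵇ⇔ P I) ideal)))
    (λ eq → let covers , ideal = Equivalence.from (enumerates I) (Equivalence.to (does≡true⇔ (I ∈ˢ? Ws)) eq) in
      ∧-intro (Equivalence.from (coversᵇ⇔ u I) covers) (Equivalence.from (isOrderIdealᵇ⇔ P I) ideal)))

∁ᵇ : ∀ {n} → (Fin n → Bool) → Subset n
∁ᵇ v = tabulate (not ∘ v)

≡-∁ᵇ : ∀ {n} {I : Subset n} (v : Fin n → Bool) → (∀ p → lookup I p ≡ not (v p)) → I ≡ ∁ᵇ v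
≡-∁ᵇ {I = I} v agree = trans (sym (tabulate∘lookup I)) (tabulate-cong agree)

∁ᵇ-≢ : ∀ {n} {v w : Fin n → Bool} p → v p ≢ w p → ∁ᵇ v ≢ ∁ᵇ w
∁ᵇ-≢ {v = v} {w} p vp≢wp eq = vp≢wp (not-injective (begin
  not (v p)              ≡⟨ lookup∘tabulate (not ∘ v) p ⟨
  lookup (∁ᵇ v) p        ≡⟨ cong (λ W → lookup W p) eq ⟩
  lookup (∁ᵇ w) p        ≡⟨ lookup∘tabulate (not ∘ w) p ⟩
  not (w p)              ∎))
  where open ≡-Reasoning

∁ᵇ-covers-ideal : ∀ {n} (P : FinPoset n) {u v : Fin n → Bool} → UpClosed P v →
  (∀ p → v p ≡ true → u p ≡ true) → Covers u (∁ᵇ v) × IsOrderIdeal P (∁ᵇ v)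
∁ᵇ-covers-ideal P {u} {v} v-up v⊆u = covers , ideal
  where
  ∈∁ᵇ : ∀ p → v p ≡ false → mem p (∁ᵇ v) ≡ true
  ∈∁ᵇ p vp = trans (lookup∘tabulate (not ∘ v) p) (cong not vp)
  covers : Covers u (∁ᵇ v)
  covers p up with v p in vp
  ... | false = ∈∁ᵇ p vp
  ... | true  with () ← trans (sym up) (v⊆u p vp)
  ideal : IsOrderIdeal P (∁ᵇ v)
  ideal p q q∈ p≤q with v p in vp
  ... | false = ∈∁ᵇ p vp
  ... | true  with () ← trans (sym q∈) (trans (lookup∘tabulate (not ∘ v) q) (cong not (v-up p q vp p≤q)))

upClosed-of-dual : ∀ {n} (P : FinPoset n) (D : Subset n) → IsDualOrderIdeal P D → UpClosed P (λ p → mem p D)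
upClosed-of-dual P D D-dual p q p∈D p≤q with p ≟ q
... | yes refl = p∈D
... | no p≢q   = D-dual p q p∈D (p≤q , p≢q)

module DualTwoChain {n} (P : FinPoset n) (D : Subset n) (D-dual : IsDualOrderIdeal P D)
  {a b : Fin n} (a≢b : a ≢ b) (a≤b : le P a b ≡ true)
  (in-D : ∀ x → mem x D ≡ true → x ≡ a ⊎ x ≡ b) (a∈D : mem a D ≡ true) (b∈D : mem b D ≡ true) where

  none isB inD : Fin n → Bool
  none _ = false
  isB p  = does (p ≟ b)
  inD p  = mem p D

  inD-up : UpClosed P inD
  inD-up = upClosed-of-dual P D D-dual

  b-maximal : ∀ q → le P b q ≡ true → q ≡ b
  b-maximal q b≤q with in-D q (inD-up b q b∈D b≤q)
  ... | inj₂ q≡b = q≡b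
  ... | inj₁ refl = contradiction (FinPoset.antisym P a b a≤b b≤q) a≢b

  isB-b : isB b ≡ true
  isB-b = dec-true (b ≟ b) refl

  isB-false : ∀ p → p ≢ b → isB p ≡ false
  isB-false p = dec-false (p ≟ b)

  isB-up : UpClosed P isB
  isB-up p q isB-p p≤q with Equivalence.to (does≡true⇔ (p ≟ b)) isB-p
  ... | refl = dec-true (q ≟ b) (b-maximal q p≤q)

  isB⊆inD : ∀ p → isB p ≡ true → inD p ≡ true
  isB⊆inD p isB-p with Equivalence.to (does≡true⇔ (p ≟ b)) isB-p
  ... | refl = b∈D

  inD-outside : ∀ p → p ≢ a → p ≢ b → inD p ≡ false
  inD-outside p p≢a p≢b with inD p in p∈D
  ... | false = refl
  ... | true  with in-D p p∈D
  ...   | inj₁ p≡a = contradiction p≡a p≢a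
  ...   | inj₂ p≡b = contradiction p≡b p≢b

  determined-by-ab : ∀ {I : Subset n} (v : Fin n → Bool) →
    (∀ p → p ≢ a → p ≢ b → lookup I p ≡ true) → (∀ p → p ≢ a → p ≢ b → v p ≡ false) →
    lookup I a ≡ not (v a) → lookup I b ≡ not (v b) → I ≡ ∁ᵇ v
  determined-by-ab {I} v I-outside v-outside Ia Ib = ≡-∁ᵇ v agree
    where
    agree : ∀ p → lookup I p ≡ not (v p)
    agree p with p ≟ a | p ≟ b
    ... | yes refl | _        = Ia
    ... | no _     | yes refl = Ib
    ... | no p≢a   | no p≢b   = trans (I-outside p p≢a p≢b) (cong not (sym (v-outside p p≢a p≢b)))

  -- An order ideal containing the complement of u is the complement of an up-set inside u;
  -- here these up-sets are ∅, {b} and, for u = D, also {a, b}.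
  jOn-isB : jOn P isB ≡ 2
  jOn-isB = jOn-enumerated P isB enumerates unique
    where
    Ws : List (Subset n)
    Ws = ∁ᵇ none ∷ ∁ᵇ isB ∷ []
    enumerates : ∀ I → (Covers isB I × IsOrderIdeal P I) ⇔ I ∈ Ws
    enumerates I = mk⇔ to from
      where
      to : Covers isB I × IsOrderIdeal P I → I ∈ Ws
      to (covers , _) = classify (lookup I b) refl
        where
        I-outside : ∀ p → p ≢ a → p ≢ b → lookup I p ≡ true
        I-outside p _ p≢b = covers p (isB-false p p≢b)
        Ia : lookup I a ≡ true
        Ia = covers a (isB-false a a≢b)
        classify : ∀ c → lookup I b ≡ c → I ∈ Ws
        classify true  Ib = here (determined-by-ab none I-outside (λ _ _ _ → refl) Ia Ib)
        classify false Ib = there (here (determined-by-ab isB I-outside (λ p _ → isB-false p)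
          (trans Ia (cong not (sym (isB-false a a≢b)))) (trans Ib (cong not (sym isB-b)))))
      from : I ∈ Ws → Covers isB I × IsOrderIdeal P I
      from (here refl)         = ∁ᵇ-covers-ideal P (λ _ _ ()) (λ _ ())
      from (there (here refl)) = ∁ᵇ-covers-ideal P isB-up (λ _ isB-p → isB-p)
    unique : Unique Ws
    unique = (∁ᵇ-≢ b (λ eq → contradiction (trans eq isB-b) λ ()) ∷ []) ∷ [] ∷ []

  jOn-inD : jOn P inD ≡ 3
  jOn-inD = jOn-enumerated P inD enumerates unique
    where
    Ws : List (Subset n)
    Ws = ∁ᵇ none ∷ ∁ᵇ isB ∷ ∁ᵇ inD ∷ []
    enumerates : ∀ I → (Covers inD I × IsOrderIdeal P I) ⇔ I ∈ Ws
    enumerates I = mk⇔ to from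
      where
      to : Covers inD I × IsOrderIdeal P I → I ∈ Ws
      to (covers , ideal) = classify (lookup I a) (lookup I b) refl refl
        where
        I-outside : ∀ p → p ≢ a → p ≢ b → lookup I p ≡ true
        I-outside p p≢a p≢b = covers p (inD-outside p p≢a p≢b)
        classify : ∀ c d → lookup I a ≡ c → lookup I b ≡ d → I ∈ Ws
        classify true  true  Ia Ib = here (determined-by-ab none I-outside (λ _ _ _ → refl) Ia Ib)
        classify true  false Ia Ib = there (here (determined-by-ab isB I-outside (λ p _ → isB-false p)
          (trans Ia (cong not (sym (isB-false a a≢b)))) (trans Ib (cong not (sym isB-b)))))
        classify false false Ia Ib = there (there (here (determined-by-ab inD I-outside inD-outside
          (trans Ia (cong not (sym a∈D))) (trans Ib (cong not (sym b∈D))))))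
        classify false true  Ia Ib with () ← trans (sym (ideal a b Ib a≤b)) Ia
      from : I ∈ Ws → Covers inD I × IsOrderIdeal P I
      from (here refl)                 = ∁ᵇ-covers-ideal P (λ _ _ ()) (λ _ ())
      from (there (here refl))         = ∁ᵇ-covers-ideal P isB-up isB⊆inD
      from (there (there (here refl))) = ∁ᵇ-covers-ideal P inD-up (λ _ p∈D → p∈D)
    unique : Unique Ws
    unique = (∁ᵇ-≢ b (λ eq → contradiction (trans eq isB-b) λ ())
           ∷ ∁ᵇ-≢ b (λ eq → contradiction (trans eq b∈D) λ ()) ∷ [])
           ∷ (∁ᵇ-≢ a (λ eq → contradiction (trans (sym (isB-false a a≢b)) (trans eq a∈D)) λ ()) ∷ [])
           ∷ [] ∷ []

lemma3p6 : (n : ℕ) (P : FinPoset n) → DoubleType P →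
    (r : ℕ) → (r ≡ 2 ⊎ r ≡ 3) →
    Σ (FinPoset (n + 3)) λ P' →
      DoubleType P' × (j P' ≡ 4 * j P + r) × InducedSubposet P P'
lemma3p6 n P (D , D-dual , a , b , a≢b , a≤b , in-D , a∈D , b∈D) r r∈23 =
  subst (ExtensionOf P r) (+-comm 3 n) (extension r∈23)
  where
  open DualTwoChain P D D-dual a≢b a≤b in-D a∈D b∈D
  extension : r ≡ 2 ⊎ r ≡ 3 → ExtensionOf P r (3 + n)
  extension (inj₁ refl) = extension-of-upClosed P isB isB-up jOn-isB
  extension (inj₂ refl) = extension-of-upClosed P inD inD-up jOn-inD
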